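{- Let $n\geq 1$, $F$ a field, and $\mathcal{B}$ a symmetric bilinear form on $F^n$. Let $D\subset F^n\setminus\{\bm{0}\}$ be $(3,2)$-orthogonal with respect to $\mathcal{B}$ and suppose $\mathcal{B}(\bm{x},\bm{x})\neq 0$ for all $\bm{x}\in D$. Then $|D|\leq\max\{2n,R(3,n)-1\}$. Consequently $|D|\leq 2n$ if $1\leq n\leq 4$, and $|D|\leq \frac{n(n+1)}{2}-1$ if $n\geq 5$.
   Context: Nonzero vectors $\bm{x},\bm{y}$ are mutually orthogonal if $\mathcal{B}(\bm{x},\bm{y})=0$. A set $D\subset F^n\setminus\{\bm{0}\}$ is $(3,2)$-orthogonal if among any three distinct elements of $D$ at least two are mutually orthogonal. The Ramsey number $R(s,t)$ is the least integer such that every graph on $R(s,t)$ vertices contains a $K_s$ or its complement contains a $K_t$. -}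

module Defs where

open import Level using (Level; _⊔_; suc)
open import Algebra.Bundles using (CommutativeRing)
open import Data.Nat using (ℕ; _≤_; _∸_)
open import Data.Fin using (Fin)
open import Data.Bool using (Bool; true; false)
open import Data.List using (List; length; lookup)
open import Data.List.Relation.Unary.All using (All)
open import Data.List.Relation.Unary.AllPairs using (AllPairs)
open import Data.Product using (Σ; _×_; _,_)
open import Data.Sum using (_⊎_)
open import Relation.Nullary using (¬_)
open import Relation.Binary.PropositionalEquality using (_≡_; _≢_)
open import Function.Definitions using (Injective)

record Field (c ℓ : Level) : Set (Level.suc (c ⊔ ℓ)) where
  field
    commutativeRing : CommutativeRing c ℓ
  open CommutativeRing commutativeRing public
  field
    0≉1     : ¬ (0# ≈ 1#)
    inverse : ∀ x → ¬ (x ≈ 0#) → Σ Carrier (λ y → (x * y) ≈ 1#)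

module _ {c ℓ : Level} (F : Field c ℓ) where
  open Field F

  Vec : ℕ → Set c
  Vec n = Fin n → Carrier

  _≈ᵥ_ : ∀ {n} → Vec n → Vec n → Set ℓ
  u ≈ᵥ v = ∀ i → u i ≈ v i

  zeroᵥ : ∀ {n} → Vec n
  zeroᵥ _ = 0#

  _+ᵥ_ : ∀ {n} → Vec n → Vec n → Vec n
  (u +ᵥ v) i = u i + v i

  _•_ : ∀ {n} → Carrier → Vec n → Vec n
  (a • v) i = a * v i

  NonZeroVec : ∀ {n} → Vec n → Set ℓ
  NonZeroVec v = ¬ (v ≈ᵥ zeroᵥ)

  record IsSymBilinear {n : ℕ} (B : Vec n → Vec n → Carrier) : Set (c ⊔ ℓ) where
    field
      cong   : ∀ {u u' v v'} → u ≈ᵥ u' → v ≈ᵥ v' → B u v ≈ B u' v'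
      +-linˡ : ∀ u u' v → B (u +ᵥ u') v ≈ (B u v + B u' v)
      •-linˡ : ∀ a u v → B (a • u) v ≈ (a * B u v)
      +-linʳ : ∀ u v v' → B u (v +ᵥ v') ≈ (B u v + B u v')
      •-linʳ : ∀ a u v → B u (a • v) ≈ (a * B u v)
      sym    : ∀ u v → B u v ≈ B v u

  Orth : ∀ {n} → (Vec n → Vec n → Carrier) → Vec n → Vec n → Set ℓ
  Orth B x y = B x y ≈ 0#

  -- a finite set D ⊂ F^n, given as a duplicate-free list
  Distinct : ∀ {n} → List (Vec n) → Set (c ⊔ ℓ)
  Distinct D = AllPairs (λ x y → ¬ (x ≈ᵥ y)) D

  Is32Orthogonal : ∀ {n} → (Vec n → Vec n → Carrier) → List (Vec n) → Set ℓ
  Is32Orthogonal B D =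
    ∀ (i j k : Fin (length D)) → i ≢ j → j ≢ k → i ≢ k →
      Orth B (lookup D i) (lookup D j)
        ⊎ (Orth B (lookup D j) (lookup D k) ⊎ Orth B (lookup D i) (lookup D k))

record Graph (m : ℕ) : Set where
  field
    adj     : Fin m → Fin m → Bool
    adj-sym : ∀ u v → adj u v ≡ adj v u

HasClique : ∀ {m} → ℕ → Graph m → Set
HasClique {m} s G = Σ (Fin s → Fin m) λ f →
  Injective _≡_ _≡_ f × (∀ i j → i ≢ j → Graph.adj G (f i) (f j) ≡ true)

HasIndep : ∀ {m} → ℕ → Graph m → Set
HasIndep {m} t G = Σ (Fin t → Fin m) λ f →
  Injective _≡_ _≡_ f × (∀ i j → i ≢ j → Graph.adj G (f i) (f j) ≡ false)

RamseyProperty : ℕ → ℕ → ℕ → Set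
RamseyProperty s t m = (G : Graph m) → HasClique s G ⊎ HasIndep t G

IsRamseyNumber : ℕ → ℕ → ℕ → Set
IsRamseyNumber s t r = RamseyProperty s t r × (∀ m → RamseyProperty s t m → r ≤ m)

-- Join two points of D when they are not orthogonal.  By (3,2)-orthogonality
-- this graph has no triangle, so once |D| ≥ R(3,n) it has n pairwise
-- orthogonal points e₁, …, eₙ, an orthogonal basis of Fⁿ since B(eᵢ,eᵢ) ≠ 0.
-- Any two other points y, y′ are orthogonal: each eᵢ is orthogonal to y or to
-- y′ (apply (3,2)-orthogonality to y, y′, eᵢ), and if B(y,y′) ≠ 0 then
-- y, e₁, …, eₙ would be n + 1 independent vectors.  So the remaining points
-- form another orthogonal family, of size at most n.  The numerical bounds
-- come from R(3,t) ≤ R(3,t-1) + t and R(3,4) ≤ 9; for the latter, a graph on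
-- 9 vertices without triangles or independent 4-sets would be 3-regular,
-- with odd degree sum 27.
module Submission where

open import Defs
open import Level using (Level; 0ℓ)
open import Data.Bool using (Bool; true; false)
import Data.Bool.Properties as Bool
open import Data.Empty using (⊥; ⊥-elim)
open import Data.Fin using (Fin; zero; suc; punchIn; inject≤)
open import Data.Fin.Patterns using (0F; 1F; 2F)
open import Data.Fin.Properties using (_≟_; punchInᵢ≢i; all?; any?; ¬∀⟶∃¬; inject≤-injective)
open import Data.List using (List; []; _∷_; length; lookup; filter; allFin)
open import Data.List.Properties using (length-tabulate; filter-accept; filter-reject)
open import Data.List.Membership.Propositional using (_∈_)
open import Data.List.Membership.Propositional.Properties using (∈-filter⁻; ∈-lookup)
open import Data.List.Relation.Binary.Subset.Propositional using (_⊆_)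
open import Data.List.Relation.Binary.Subset.Propositional.Properties using (filter-⊆)
open import Data.List.Relation.Unary.All as All using (All; []; _∷_)
open import Data.List.Relation.Unary.All.Properties using (all-filter)
open import Data.List.Relation.Unary.AllPairs using (AllPairs; []; _∷_)
open import Data.List.Relation.Unary.Any using (here; there)
open import Data.List.Relation.Unary.Unique.Propositional using (Unique)
import Data.List.Relation.Unary.Unique.Propositional.Properties as Unique
open import Data.Nat using (ℕ; zero; suc; _≤_; s≤s; z≤n; _≤?_)
open import Data.Nat.Properties using (1+n≰n; m≤n⇒m≤1+n)
open import Data.Nat.DivMod using (m*n%n≡0; m*n/n≡m)
open import Data.Nat.Solver using (module +-*-Solver)
open import Data.Product using (Σ; ∃; _×_; _,_; proj₁; proj₂)
open import Data.Sum using (_⊎_; inj₁; inj₂; [_,_])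
import Data.Sum as Sum
import Data.Sum.Effectful.Left as Sumₗ
open import Data.Vec.Functional using (tail; insertAt)
import Data.Vec.Functional as Vector
open import Data.Vec.Functional.Properties using (insertAt-lookup; insertAt-punchIn)
open import Function using (_∘_; id)
open import Function.Definitions using (Injective)
open import Relation.Binary.Core using (Rel)
open import Relation.Binary.Definitions using (Symmetric)
open import Relation.Binary.PropositionalEquality using (_≡_; _≢_)
open import Relation.Nullary using (¬_; Dec; yes; no; ¬?)
open import Relation.Nullary.Decidable using (_×-dec_; ¬¬-excluded-middle; decidable-stable)
open import Relation.Nullary.Negation using (¬¬-map; contradiction)
open import Relation.Unary using (Pred)
open import Relation.Unary.Properties using (∁?)

¬¬-∀-Fin : ∀ {p k} {P : Fin k → Set p} → (∀ i → ¬ ¬ P i) → ¬ ¬ (∀ i → P i)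
¬¬-∀-Fin {k = zero} _ ¬all = ¬all (λ ())
¬¬-∀-Fin {k = suc k} h ¬all =
  h zero λ p₀ → ¬¬-∀-Fin (h ∘ suc) λ ps → ¬all λ { zero → p₀ ; (suc i) → ps i }

¬¬-decide-Fin : ∀ {p k} {P : Fin k → Set p} → ¬ ¬ (∀ i → Dec (P i))
¬¬-decide-Fin = ¬¬-∀-Fin (λ _ → ¬¬-excluded-middle)

module LinearAlgebra {c ℓ : Level} (F : Field c ℓ) where

  open Field F hiding (zero)
  open import Algebra.Properties.Semiring.Sum semiring
    using (sum; sum-cong-≋; sum-replicate-zero; sum-remove; ∑-distrib-+; *-distribʳ-sum)
  open import Algebra.Properties.Ring ring using (-‿distribˡ-*)
  open import Relation.Binary.Reasoning.Setoid setoid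

  x*y≈0⇒x≈0 : ∀ {x y} → ¬ y ≈ 0# → x * y ≈ 0# → x ≈ 0#
  x*y≈0⇒x≈0 {x} {y} y≉0 xy≈0 with inverse y y≉0
  ... | y⁻¹ , yy⁻¹≈1 = begin
    x              ≈⟨ *-identityʳ x ⟨
    x * 1#         ≈⟨ *-congˡ yy⁻¹≈1 ⟨
    x * (y * y⁻¹)  ≈⟨ *-assoc x y y⁻¹ ⟨
    (x * y) * y⁻¹  ≈⟨ *-congʳ xy≈0 ⟩
    0# * y⁻¹       ≈⟨ zeroˡ y⁻¹ ⟩
    0#             ∎

  sum-zero : ∀ {k} {t : Fin k → Carrier} → (∀ j → t j ≈ 0#) → sum t ≈ 0#
  sum-zero {k} t≈0 = trans (sum-cong-≋ t≈0) (sum-replicate-zero k)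

  sum-single : ∀ {k} {t : Fin k → Carrier} i → (∀ j → j ≢ i → t j ≈ 0#) → sum t ≈ t i
  sum-single {suc k} {t} i others≈0 = begin
    sum t                               ≈⟨ sum-remove t ⟩
    t i + sum (t ∘ punchIn i)           ≈⟨ +-congˡ (sum-zero (λ l → others≈0 (punchIn i l) (punchInᵢ≢i i l))) ⟩
    t i + 0#                            ≈⟨ +-identityʳ (t i) ⟩
    t i                                 ∎

  combination : ∀ {k n} → (Fin k → Carrier) → (Fin k → Vec F n) → Vec F n
  combination a w i = sum (λ j → a j * w j i)

  LinearlyIndependent : ∀ {k n} → (Fin k → Vec F n) → Set (c Level.⊔ ℓ)
  LinearlyIndependent w = ∀ a → (∀ i → combination a w i ≈ 0#) → ∀ j → a j ≈ 0#

  -- A relation Σₗ bₗ uₗ = 0 among the new vectors uₗ is the relation among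
  -- the w with the coefficient Σₗ bₗ sₗ inserted at position j.
  shear-independent : ∀ {k n} (w : Fin (suc k) → Vec F n) → LinearlyIndependent w →
                      ∀ j (s : Fin k → Carrier) →
                      LinearlyIndependent (λ l i → w (punchIn j l) i + s l * w j i)
  shear-independent {k} w ind j s b rel l = begin
    b l                  ≡⟨ insertAt-punchIn b j t l ⟨
    a (punchIn j l)      ≈⟨ ind a rel′ (punchIn j l) ⟩
    0#                   ∎
    where
    t : Carrier
    t = sum (λ l → b l * s l)
    a : Fin (suc k) → Carrier
    a = insertAt b j t
    rel′ : ∀ i → combination a w i ≈ 0#
    rel′ i = begin
      sum (λ j′ → a j′ * w j′ i)
        ≈⟨ sum-remove (λ j′ → a j′ * w j′ i) ⟩
      a j * w j i + sum (λ l → a (punchIn j l) * w (punchIn j l) i)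
        ≈⟨ +-cong (*-congʳ (reflexive (insertAt-lookup b j t)))
                  (sum-cong-≋ (λ l → *-congʳ (reflexive (insertAt-punchIn b j t l)))) ⟩
      t * w j i + sum (λ l → b l * w (punchIn j l) i)
        ≈⟨ +-comm _ _ ⟩
      sum (λ l → b l * w (punchIn j l) i) + t * w j i
        ≈⟨ +-congˡ (*-distribʳ-sum (w j i) (λ l → b l * s l)) ⟩
      sum (λ l → b l * w (punchIn j l) i) + sum (λ l → (b l * s l) * w j i)
        ≈⟨ ∑-distrib-+ (λ l → b l * w (punchIn j l) i) (λ l → (b l * s l) * w j i) ⟨
      sum (λ l → b l * w (punchIn j l) i + (b l * s l) * w j i)
        ≈⟨ sum-cong-≋ (λ l → trans (+-congˡ (*-assoc (b l) (s l) (w j i)))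
                                    (sym (distribˡ (b l) _ _))) ⟩
      sum (λ l → b l * (w (punchIn j l) i + s l * w j i))
        ≈⟨ rel i ⟩
      0#  ∎

  tail-independent : ∀ {k n} (w : Fin k → Vec F (suc n)) → LinearlyIndependent w →
                     (∀ j → w j zero ≈ 0#) → LinearlyIndependent (tail ∘ w)
  tail-independent w ind head≈0 a rel = ind a λ where
    zero    → sum-zero (λ j → trans (*-congˡ (head≈0 j)) (zeroʳ (a j)))
    (suc i) → rel i

  pivot-clears : ∀ {p q} → p * q ≈ 1# → ∀ x → x + - (x * q) * p ≈ 0#
  pivot-clears {p} {q} pq≈1 x = begin
    x + - (x * q) * p     ≈⟨ +-congˡ (-‿distribˡ-* (x * q) p) ⟨
    x + - ((x * q) * p)   ≈⟨ +-congˡ (-‿cong (trans (*-assoc x q p) (*-congˡ (trans (*-comm q p) pq≈1)))) ⟩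
    x + - (x * 1#)        ≈⟨ +-congˡ (-‿cong (*-identityʳ x)) ⟩
    x + - x               ≈⟨ -‿inverseʳ x ⟩
    0#                    ∎

  -- Gaussian elimination on the first coordinate.  Whether that column
  -- vanishes is undecidable, but k ≤ n is decidable, hence stable under ¬¬.
  independent⇒≤ : ∀ {k n} (w : Fin k → Vec F n) → LinearlyIndependent w → k ≤ n
  independent⇒≤ {zero} _ _ = z≤n
  independent⇒≤ {suc k} {zero} w ind = contradiction (sym (ind (λ _ → 1#) (λ ()) zero)) 0≉1
  independent⇒≤ {suc k} {suc n} w ind =
    decidable-stable (suc k ≤? suc n) (¬¬-map eliminate ¬¬-decide-Fin)
    where
    eliminate : (∀ j → Dec (w j zero ≈ 0#)) → suc k ≤ suc n
    eliminate zero? with all? zero?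
    ... | yes column≈0 = m≤n⇒m≤1+n (independent⇒≤ (tail ∘ w) (tail-independent w ind column≈0))
    ... | no column≉0 with ¬∀⟶∃¬ _ _ zero? column≉0
    ...   | j , pivot≉0 with inverse (w j zero) pivot≉0
    ...     | q , pq≈1 = s≤s (independent⇒≤ (tail ∘ u)
                (tail-independent u (shear-independent w ind j s) (λ l → pivot-clears pq≈1 _)))
      where
      s : Fin k → Carrier
      s l = - (w (punchIn j l) zero * q)
      u : Fin k → Vec F (suc n)
      u l i = w (punchIn j l) i + s l * w j i

  module _ {n} {B : Vec F n → Vec F n → Carrier} (isB : IsSymBilinear F B) where

    open IsSymBilinear isB renaming (cong to B-cong; sym to B-sym)

    B-zeroˡ : ∀ x → B (zeroᵥ F) x ≈ 0#
    B-zeroˡ x = begin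
      B (zeroᵥ F) x          ≈⟨ B-cong (λ _ → sym (zeroˡ 0#)) (λ _ → refl) ⟩
      B (_•_ F 0# (zeroᵥ F)) x ≈⟨ •-linˡ 0# (zeroᵥ F) x ⟩
      0# * B (zeroᵥ F) x     ≈⟨ zeroˡ _ ⟩
      0#                     ∎

    B-combinationˡ : ∀ {k} a (w : Fin k → Vec F n) x →
                     B (combination a w) x ≈ sum (λ j → a j * B (w j) x)
    B-combinationˡ {zero} a w x = B-zeroˡ x
    B-combinationˡ {suc k} a w x = begin
      B (combination a w) x
        ≈⟨ B-cong (λ _ → refl) (λ _ → refl) ⟩
      B (_+ᵥ_ F (_•_ F (a zero) (w zero)) (combination (tail a) (tail w))) x
        ≈⟨ +-linˡ _ _ x ⟩
      B (_•_ F (a zero) (w zero)) x + B (combination (tail a) (tail w)) x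
        ≈⟨ +-cong (•-linˡ (a zero) (w zero) x) (B-combinationˡ (tail a) (tail w) x) ⟩
      a zero * B (w zero) x + sum (λ j → a (suc j) * B (w (suc j)) x)
        ∎

    pairing-vanishes : ∀ {k} a (w : Fin k → Vec F n) → (∀ i → combination a w i ≈ 0#) →
                       ∀ x → sum (λ j → a j * B (w j) x) ≈ 0#
    pairing-vanishes a w rel x = begin
      sum (λ j → a j * B (w j) x)  ≈⟨ B-combinationˡ a w x ⟨
      B (combination a w) x        ≈⟨ B-cong rel (λ _ → refl) ⟩
      B (zeroᵥ F) x                ≈⟨ B-zeroˡ x ⟩
      0#                           ∎

    orthogonal⇒independent : ∀ {k} (w : Fin k → Vec F n) →
                             (∀ i j → i ≢ j → B (w i) (w j) ≈ 0#) →
                             (∀ i → ¬ B (w i) (w i) ≈ 0#) → LinearlyIndependent w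
    orthogonal⇒independent w orth anisotropic a rel j = x*y≈0⇒x≈0 (anisotropic j) (begin
      a j * B (w j) (w j)              ≈⟨ sum-single {t = λ i → a i * B (w i) (w j)} j
                                            (λ i i≢j → trans (*-congˡ (orth i j i≢j)) (zeroʳ (a i))) ⟨
      sum (λ i → a i * B (w i) (w j))  ≈⟨ pairing-vanishes a w rel (w j) ⟩
      0#                               ∎)

    -- The n + 1 vectors y, e₀, …, eₙ₋₁ would otherwise be independent in Fⁿ.
    ¬¬-orthogonal-of-split : (e : Fin n → Vec F n) → (∀ i j → i ≢ j → B (e i) (e j) ≈ 0#) →
                             (∀ i → ¬ B (e i) (e i) ≈ 0#) →
                             ∀ y y′ → (∀ i → B y (e i) ≈ 0# ⊎ B y′ (e i) ≈ 0#) → ¬ ¬ B y y′ ≈ 0#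
    ¬¬-orthogonal-of-split e orth anisotropic y y′ split y≉y′ =
      1+n≰n (independent⇒≤ (y Vector.∷ e) independent)
      where
      independent : LinearlyIndependent (y Vector.∷ e)
      independent a rel = coefficient≈0
        where
        pairing-with-e : ∀ i → a zero * B y (e i) + a (suc i) * B (e i) (e i) ≈ 0#
        pairing-with-e i = trans (+-congˡ (sym (sum-single {t = λ l → a (suc l) * B (e l) (e i)} i
                                         (λ l l≢i → trans (*-congˡ (orth l i l≢i)) (zeroʳ _)))))
                        (pairing-vanishes a (y Vector.∷ e) rel (e i))
        coefficient-of-e≈0 : ∀ i → a zero * B y (e i) ≈ 0# → a (suc i) ≈ 0#
        coefficient-of-e≈0 i first≈0 = x*y≈0⇒x≈0 (anisotropic i) (begin
          a (suc i) * B (e i) (e i)                       ≈⟨ +-identityˡ _ ⟨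
          0# + a (suc i) * B (e i) (e i)                  ≈⟨ +-congʳ first≈0 ⟨
          a zero * B y (e i) + a (suc i) * B (e i) (e i)  ≈⟨ pairing-with-e i ⟩
          0#                                              ∎)
        a₀≈0 : a zero ≈ 0#
        a₀≈0 = x*y≈0⇒x≈0 y≉y′ (begin
          a zero * B y y′                                       ≈⟨ +-identityʳ (a zero * B y y′) ⟨
          a zero * B y y′ + 0#                                  ≈⟨ +-congˡ (sum-zero term≈0) ⟨
          a zero * B y y′ + sum (λ i → a (suc i) * B (e i) y′)  ≈⟨ pairing-vanishes a (y Vector.∷ e) rel y′ ⟩
          0#                                                    ∎)
          where
          term≈0 : ∀ i → a (suc i) * B (e i) y′ ≈ 0#
          term≈0 i with split i
          ... | inj₁ y⊥eᵢ  = trans (*-congʳ (coefficient-of-e≈0 i (trans (*-congˡ y⊥eᵢ) (zeroʳ _)))) (zeroˡ _)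
          ... | inj₂ y′⊥eᵢ = trans (*-congˡ (trans (B-sym (e i) y′) y′⊥eᵢ)) (zeroʳ _)
        coefficient≈0 : ∀ j → a j ≈ 0#
        coefficient≈0 zero    = a₀≈0
        coefficient≈0 (suc i) = coefficient-of-e≈0 i (trans (*-congʳ a₀≈0) (zeroˡ _))

open import Data.Nat.Properties
  using (≤-pred; ≤-trans; ≤-refl; ≤-reflexive; ≤-antisym; ≰⇒>; +-identityʳ;
         +-cancelˡ-≤; +-cancelʳ-≤; +-monoˡ-≤; +-monoʳ-≤; +-mono-≤; *-comm;
         m≤n+m∸n; m∸n≤m; m≤n⇒m≤n⊔o; m≤n⇒m≤o⊔n; ⊔-lub; m≤m+n; +-suc; +-commutativeSemigroup; module ≤-Reasoning)
open import Algebra.Properties.CommutativeSemigroup +-commutativeSemigroup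
  using () renaming (interchange to +-interchange)
open import Data.Nat using (_+_; _*_; _∸_; _⊔_; _/_; _%_)
open import Relation.Binary.PropositionalEquality using (refl; sym; trans; cong; cong₂; module ≡-Reasoning)

AllPairs-lookup : ∀ {a r} {A : Set a} {R : Rel A r} → Symmetric R → ∀ {xs} → AllPairs R xs →
                  ∀ {i j} → i ≢ j → R (lookup xs i) (lookup xs j)
AllPairs-lookup R-sym (_ ∷ _)     {zero}  {zero}  0≢0 = contradiction refl 0≢0
AllPairs-lookup R-sym (Rx ∷ _)    {zero}  {suc j} _   = All.lookup Rx (∈-lookup j)
AllPairs-lookup R-sym (Rx ∷ _)    {suc i} {zero}  _   = R-sym (All.lookup Rx (∈-lookup i))
AllPairs-lookup R-sym (_ ∷ Rxs)   {suc i} {suc j} i≢j = AllPairs-lookup R-sym Rxs (i≢j ∘ cong suc)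

Unique⇒AllPairs : ∀ {a p r} {A : Set a} {P : Pred A p} {R : Rel A r} →
                  (∀ {x y} → P x → P y → x ≢ y → R x y) →
                  ∀ {xs} → All P xs → Unique xs → AllPairs R xs
Unique⇒AllPairs R-from [] [] = []
Unique⇒AllPairs R-from (px ∷ pxs) (x∉xs ∷ unique) =
  All.zipWith (λ (py , x≢y) → R-from px py x≢y) (pxs , x∉xs) ∷ Unique⇒AllPairs R-from pxs unique

length-filter-∁ : ∀ {a p} {A : Set a} {P : Pred A p} (P? : ∀ x → Dec (P x)) xs →
                  length (filter P? xs) + length (filter (∁? P?) xs) ≡ length xs
length-filter-∁ P? [] = refl
length-filter-∁ P? (x ∷ xs) with P? x
... | yes _ = cong suc (length-filter-∁ P? xs)
... | no _  = trans (+-suc _ _) (cong suc (length-filter-∁ P? xs))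

-- R(3,t) ≤ R(2,t) + R(3,t-1) = t + R(3,t-1), except that R(3,4) = 9 is one less.
ramsey₃-bound : ℕ → ℕ
ramsey₃-bound 0 = 0
ramsey₃-bound 1 = 1
ramsey₃-bound 2 = 3
ramsey₃-bound 3 = 6
ramsey₃-bound 4 = 9
ramsey₃-bound (suc t@(suc (suc (suc (suc _))))) = suc t + ramsey₃-bound t

module Ramsey {m : ℕ} (G : Graph m) where

  open Graph G

  -- Colour true is an edge, false a non-edge; Graph allows loops, so
  -- distinctness is part of being coloured.
  Coloured : Bool → Fin m → Fin m → Set
  Coloured b u w = u ≢ w × adj u w ≡ b

  coloured? : ∀ b u w → Dec (Coloured b u w)
  coloured? b u w = ¬? (u ≟ w) ×-dec (adj u w Bool.≟ b)

  coloured-sym : ∀ {b} → Symmetric (Coloured b)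
  coloured-sym (u≢w , uw≡b) = u≢w ∘ sym , trans (adj-sym _ _) uw≡b

  MonochromaticIn : Bool → ℕ → List (Fin m) → Set
  MonochromaticIn b s ys = Σ (List (Fin m)) λ zs → s ≤ length zs × zs ⊆ ys × AllPairs (Coloured b) zs

  HasMonochromatic : ℕ → ℕ → List (Fin m) → Set
  HasMonochromatic s t ys = MonochromaticIn true s ys ⊎ MonochromaticIn false t ys

  RamseyBound : ℕ → ℕ → ℕ → Set
  RamseyBound s t k = ∀ ys → Unique ys → k ≤ length ys → HasMonochromatic s t ys

  neighbours : Bool → Fin m → List (Fin m) → List (Fin m)
  neighbours b u = filter (coloured? b u)

  degree : Bool → Fin m → List (Fin m) → ℕ
  degree b u ys = length (neighbours b u ys)

  degree-single : ∀ {b u w} → Coloured b u w → degree b u (w ∷ []) ≡ 1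
  degree-single c = cong length (filter-accept (coloured? _ _) c)

  degree-single-¬ : ∀ {b u w} → ¬ Coloured b u w → degree b u (w ∷ []) ≡ 0
  degree-single-¬ ¬c = cong length (filter-reject (coloured? _ _) ¬c)

  degree-self : ∀ b u → degree b u (u ∷ []) ≡ 0
  degree-self b u = degree-single-¬ {b} {u} {u} λ (u≢u , _) → u≢u refl

  degree-∷ : ∀ b u y ys → degree b u (y ∷ ys) ≡ degree b u (y ∷ []) + degree b u ys
  degree-∷ b u y ys with coloured? b u y
  ... | yes uy = trans (cong length (filter-accept (coloured? b u) uy)) (cong (_+ _) (sym (degree-single uy)))
  ... | no ¬uy = trans (cong length (filter-reject (coloured? b u) ¬uy)) (cong (_+ _) (sym (degree-single-¬ ¬uy)))

  degree-sym : ∀ b u w → degree b u (w ∷ []) ≡ degree b w (u ∷ [])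
  degree-sym b u w with coloured? b u w | coloured? b w u
  ... | yes uw | yes wu = trans (degree-single uw) (sym (degree-single wu))
  ... | no ¬uw | no ¬wu = trans (degree-single-¬ ¬uw) (sym (degree-single-¬ ¬wu))
  ... | yes uw | no ¬wu = contradiction (coloured-sym uw) ¬wu
  ... | no ¬uw | yes wu = contradiction (coloured-sym wu) ¬uw

  total-degree : Fin m → List (Fin m) → ℕ
  total-degree u ys = degree true u ys + degree false u ys

  total-degree-∷ : ∀ u y ys → total-degree u (y ∷ ys) ≡ total-degree u (y ∷ []) + total-degree u ys
  total-degree-∷ u y ys = trans (cong₂ _+_ (degree-∷ true u y ys) (degree-∷ false u y ys))
                                (+-interchange (degree true u (y ∷ [])) (degree true u ys)
                                               (degree false u (y ∷ [])) (degree false u ys))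

  total-degree-single : ∀ {u w} → u ≢ w → total-degree u (w ∷ []) ≡ 1
  total-degree-single {u} {w} u≢w with coloured? true u w | coloured? false u w
  ... | yes (_ , t) | yes (_ , f) = contradiction (trans (sym t) f) λ ()
  ... | yes t       | no ¬f       = cong₂ _+_ (degree-single t) (degree-single-¬ ¬f)
  ... | no ¬t       | yes f       = cong₂ _+_ (degree-single-¬ ¬t) (degree-single f)
  ... | no ¬t       | no ¬f       = contradiction (u≢w , Bool.¬-not (¬f ∘ (u≢w ,_))) ¬t

  total-degree-self : ∀ u → total-degree u (u ∷ []) ≡ 0
  total-degree-self u = cong₂ _+_ (degree-self true u) (degree-self false u)

  total-degree≡length : ∀ {u ys} → All (u ≢_) ys → total-degree u ys ≡ length ys
  total-degree≡length {u} {[]} [] = refl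
  total-degree≡length {u} {y ∷ ys} (u≢y ∷ u≢ys) = begin
    total-degree u (y ∷ ys)                       ≡⟨ total-degree-∷ u y ys ⟩
    total-degree u (y ∷ []) + total-degree u ys   ≡⟨ cong₂ _+_ (total-degree-single u≢y) (total-degree≡length u≢ys) ⟩
    suc (length ys)                               ∎
    where open ≡-Reasoning

  -- Every vertex other than u is a neighbour of u in exactly one colour.
  length≤1+total-degree : ∀ u {ys} → Unique ys → length ys ≤ suc (total-degree u ys)
  length≤1+total-degree u {[]} [] = z≤n
  length≤1+total-degree u {y ∷ ys} (y∉ys ∷ unique) with y ≟ u
  ... | yes refl = s≤s (≤-reflexive (begin
    length ys                                    ≡⟨ total-degree≡length y∉ys ⟨
    total-degree y ys                            ≡⟨ cong (_+ total-degree y ys) (total-degree-self y) ⟨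
    total-degree y (y ∷ []) + total-degree y ys  ≡⟨ total-degree-∷ y y ys ⟨
    total-degree y (y ∷ ys)                      ∎))
    where open ≡-Reasoning
  ... | no y≢u = begin
    suc (length ys)                              ≤⟨ s≤s (length≤1+total-degree u unique) ⟩
    suc (suc (total-degree u ys))                ≡⟨ cong (λ d → suc (d + total-degree u ys)) (total-degree-single (y≢u ∘ sym)) ⟨
    suc (total-degree u (y ∷ []) + total-degree u ys)   ≡⟨ cong suc (total-degree-∷ u y ys) ⟨
    suc (total-degree u (y ∷ ys))                ∎
    where open ≤-Reasoning

  degree-sum : List (Fin m) → List (Fin m) → ℕ
  degree-sum []       ys = 0
  degree-sum (x ∷ xs) ys = degree true x ys + degree-sum xs ys

  edges : List (Fin m) → ℕ
  edges []       = 0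
  edges (y ∷ ys) = degree true y ys + edges ys

  degree-sum-∷ : ∀ xs y ys → degree-sum xs (y ∷ ys) ≡ degree true y xs + degree-sum xs ys
  degree-sum-∷ []       y ys = refl
  degree-sum-∷ (x ∷ xs) y ys = begin
    degree true x (y ∷ ys) + degree-sum xs (y ∷ ys)
      ≡⟨ cong₂ _+_ (degree-∷ true x y ys) (degree-sum-∷ xs y ys) ⟩
    (degree true x (y ∷ []) + degree true x ys) + (degree true y xs + degree-sum xs ys)
      ≡⟨ cong (λ d → (d + degree true x ys) + (degree true y xs + degree-sum xs ys)) (degree-sym true x y) ⟩
    (degree true y (x ∷ []) + degree true x ys) + (degree true y xs + degree-sum xs ys)
      ≡⟨ +-interchange (degree true y (x ∷ [])) (degree true x ys) (degree true y xs) (degree-sum xs ys) ⟩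
    (degree true y (x ∷ []) + degree true y xs) + (degree true x ys + degree-sum xs ys)
      ≡⟨ cong (_+ (degree true x ys + degree-sum xs ys)) (degree-∷ true y x xs) ⟨
    degree true y (x ∷ xs) + degree-sum (x ∷ xs) ys
      ∎
    where open ≡-Reasoning

  handshake : ∀ ys → degree-sum ys ys ≡ 2 * edges ys
  handshake []       = refl
  handshake (y ∷ ys) = begin
    degree true y (y ∷ ys) + degree-sum ys (y ∷ ys)
      ≡⟨ cong₂ _+_ (trans (degree-∷ true y y ys) (cong (_+ d) (degree-self true y)))
                   (degree-sum-∷ ys y ys) ⟩
    d + (d + degree-sum ys ys)
      ≡⟨ cong (λ s → d + (d + s)) (handshake ys) ⟩
    d + (d + 2 * edges ys)
      ≡⟨ solve 2 (λ d e → d :+ (d :+ con 2 :* e) := con 2 :* (d :+ e)) refl d (edges ys) ⟩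
    2 * (d + edges ys)
      ∎
    where
    open ≡-Reasoning
    open +-*-Solver
    d : ℕ
    d = degree true y ys

  degree-sum-regular : ∀ {r xs ys} → All (λ u → degree true u ys ≡ r) xs → degree-sum xs ys ≡ length xs * r
  degree-sum-regular []                = refl
  degree-sum-regular (d≡r ∷ regular) = cong₂ _+_ d≡r (degree-sum-regular regular)

  MonochromaticIn-⊆ : ∀ {b s ys ys′} → ys ⊆ ys′ → MonochromaticIn b s ys → MonochromaticIn b s ys′
  MonochromaticIn-⊆ ys⊆ys′ (zs , s≤ , zs⊆ys , mono) = zs , s≤ , ys⊆ys′ ∘ zs⊆ys , mono

  extend : ∀ {b s u ys} → u ∈ ys → MonochromaticIn b s (neighbours b u ys) → MonochromaticIn b (suc s) ys
  extend {b} {u = u} {ys} u∈ys (zs , s≤ , zs⊆ , mono) =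
    u ∷ zs , s≤s s≤ , u∷zs⊆ys , All.tabulate (proj₂ ∘ ∈-filter⁻ (coloured? b u) {xs = ys} ∘ zs⊆) ∷ mono
    where
    u∷zs⊆ys : u ∷ zs ⊆ ys
    u∷zs⊆ys (here refl)   = u∈ys
    u∷zs⊆ys (there z∈zs) = filter-⊆ (coloured? b u) ys (zs⊆ z∈zs)

  via-neighbours : ∀ {s t k u ys} → RamseyBound s (suc t) k → Unique ys → u ∈ ys →
                   k ≤ degree true u ys → HasMonochromatic (suc s) (suc t) ys
  via-neighbours {u = u} {ys} R unique u∈ys k≤ =
    Sum.map (extend u∈ys) (MonochromaticIn-⊆ (filter-⊆ (coloured? true u) ys))
            (R _ (Unique.filter⁺ (coloured? true u) unique) k≤)

  via-non-neighbours : ∀ {s t k u ys} → RamseyBound (suc s) t k → Unique ys → u ∈ ys →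
                       k ≤ degree false u ys → HasMonochromatic (suc s) (suc t) ys
  via-non-neighbours {u = u} {ys} R unique u∈ys k≤ =
    Sum.map (MonochromaticIn-⊆ (filter-⊆ (coloured? false u) ys)) (extend u∈ys)
            (R _ (Unique.filter⁺ (coloured? false u) unique) k≤)

  ramsey-step : ∀ {s t a b} → RamseyBound s (suc t) (suc a) → RamseyBound (suc s) t b →
                RamseyBound (suc s) (suc t) (suc a + b)
  ramsey-step R₁ R₂ [] _ ()
  ramsey-step {a = a} {b} R₁ R₂ ys@(u ∷ _) unique len with suc a ≤? degree true u ys
  ... | yes many = via-neighbours R₁ unique (here refl) many
  ... | no few   = via-non-neighbours R₂ unique (here refl) (+-cancelˡ-≤ (degree true u ys) b _ (begin
    degree true u ys + b   ≤⟨ +-monoˡ-≤ b (≤-pred (≰⇒> few)) ⟩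
    a + b                  ≤⟨ ≤-pred (≤-trans len (length≤1+total-degree u unique)) ⟩
    total-degree u ys      ∎))
    where open ≤-Reasoning

  ramsey-0 : ∀ {s} → RamseyBound s 0 0
  ramsey-0 _ _ _ = inj₂ ([] , z≤n , (λ ()) , [])

  ramsey-1 : ∀ {t} → RamseyBound 1 t 1
  ramsey-1 (y ∷ _) _ _ = inj₁ (y ∷ [] , ≤-refl , (λ { (here refl) → here refl }) , [] ∷ [])

  -- A vertex with 4 neighbours or 6 non-neighbours reduces to R(2,4) or
  -- R(3,3); otherwise there are exactly 9 vertices, all of degree 3.
  ramsey-3-4 : RamseyBound 3 3 6 → RamseyBound 2 4 4 → RamseyBound 3 4 9
  ramsey-3-4 R₃₃ R₂₄ [] _ ()
  ramsey-3-4 R₃₃ R₂₄ ys@(_ ∷ _) unique 9≤len =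
    [ id , ⊥-elim ∘ regular-impossible ] (All.sequenceA 0ℓ (Sumₗ.applicative _ 0ℓ) (All.tabulate classify))
    where
    Regular : Fin m → Set
    Regular u = degree true u ys ≡ 3 × length ys ≡ 9
    classify : ∀ {u} → u ∈ ys → HasMonochromatic 3 4 ys ⊎ Regular u
    classify {u} u∈ys with 4 ≤? degree true u ys | 6 ≤? degree false u ys
    ... | yes 4≤ | _      = inj₁ (via-neighbours R₂₄ unique u∈ys 4≤)
    ... | no _   | yes 6≤ = inj₁ (via-non-neighbours R₃₃ unique u∈ys 6≤)
    ... | no ¬4≤ | no ¬6≤ = inj₂ (squeeze (≤-pred (≰⇒> ¬4≤)) (≤-pred (≰⇒> ¬6≤)) (length≤1+total-degree u unique))
      where
      squeeze : ∀ {d e} → d ≤ 3 → e ≤ 5 → length ys ≤ suc (d + e) → d ≡ 3 × length ys ≡ 9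
      squeeze {d} {e} d≤3 e≤5 len≤ =
        ≤-antisym d≤3 (+-cancelʳ-≤ 5 3 d (≤-trans (≤-pred (≤-trans 9≤len len≤)) (+-monoʳ-≤ d e≤5))) ,
        ≤-antisym (≤-trans len≤ (s≤s (+-mono-≤ d≤3 e≤5))) 9≤len
    regular-impossible : All Regular ys → ⊥
    regular-impossible regular = contradiction (begin
      1                      ≡⟨⟩
      (9 * 3) % 2            ≡⟨ cong (λ l → (l * 3) % 2) (proj₂ (All.head regular)) ⟨
      (length ys * 3) % 2    ≡⟨ cong (_% 2) (degree-sum-regular {ys = ys} (All.map proj₁ regular)) ⟨
      degree-sum ys ys % 2   ≡⟨ cong (_% 2) (trans (handshake ys) (*-comm 2 (edges ys))) ⟩
      (edges ys * 2) % 2     ≡⟨ m*n%n≡0 (edges ys) 2 ⟩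
      0                      ∎) λ ()
      where open ≡-Reasoning

  ramsey₂ : ∀ t → RamseyBound 2 t t
  ramsey₂ zero    = ramsey-0
  ramsey₂ (suc t) = ramsey-step ramsey-1 (ramsey₂ t)

  ramsey₃ : ∀ t → RamseyBound 3 t (ramsey₃-bound t)
  ramsey₃ 0 = ramsey-0
  ramsey₃ 1 = ramsey-step (ramsey₂ 1) (ramsey₃ 0)
  ramsey₃ 2 = ramsey-step (ramsey₂ 2) (ramsey₃ 1)
  ramsey₃ 3 = ramsey-step (ramsey₂ 3) (ramsey₃ 2)
  ramsey₃ 4 = ramsey-3-4 (ramsey₃ 3) (ramsey₂ 4)
  ramsey₃ (suc t@(suc (suc (suc (suc _))))) = ramsey-step (ramsey₂ (suc t)) (ramsey₃ t)

  -- For b = true and b = false this is HasClique s G and HasIndep s G.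
  monochromatic-family : ∀ {b s ys} → MonochromaticIn b s ys →
    Σ (Fin s → Fin m) λ f → Injective _≡_ _≡_ f × (∀ i j → i ≢ j → adj (f i) (f j) ≡ b)
  monochromatic-family {b} {s} (zs , s≤ , _ , mono) = f , injective , λ i j → proj₂ ∘ coloured {i} {j}
    where
    f : Fin s → Fin m
    f i = lookup zs (inject≤ i s≤)
    coloured : ∀ {i j} → i ≢ j → Coloured b (f i) (f j)
    coloured i≢j = AllPairs-lookup coloured-sym mono (i≢j ∘ inject≤-injective s≤ s≤ _ _)
    injective : Injective _≡_ _≡_ f
    injective {i} {j} fi≡fj with i ≟ j
    ... | yes i≡j = i≡j
    ... | no i≢j  = contradiction fi≡fj (proj₁ (coloured i≢j))

ramsey₃-property : ∀ t → RamseyProperty 3 t (ramsey₃-bound t)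
ramsey₃-property t G =
  Sum.map monochromatic-family monochromatic-family
          (ramsey₃ t (allFin _) (Unique.allFin⁺ _) (≤-reflexive (sym (length-tabulate id))))
  where open Ramsey G

ramsey₃-bound-small : ∀ {n} → n ≤ 4 → 2 * n ⊔ (ramsey₃-bound n ∸ 1) ≤ 2 * n
ramsey₃-bound-small {0} _ = ≤-refl
ramsey₃-bound-small {1} _ = ≤-refl
ramsey₃-bound-small {2} _ = ≤-refl
ramsey₃-bound-small {3} _ = ≤-refl
ramsey₃-bound-small {4} _ = ≤-refl
ramsey₃-bound-small {suc (suc (suc (suc (suc _))))} (s≤s (s≤s (s≤s (s≤s ()))))

ramsey₃-bound-triangular : ∀ t → (4 + t) * (4 + t + 1) ≡ suc (ramsey₃-bound (4 + t)) * 2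
ramsey₃-bound-triangular zero    = refl
ramsey₃-bound-triangular (suc t) = begin
  (5 + t) * (5 + t + 1)                          ≡⟨ solve 1 (λ t → (con 5 :+ t) :* (con 5 :+ t :+ con 1)
                                                      := (con 5 :+ t) :* con 2 :+ (con 4 :+ t) :* (con 4 :+ t :+ con 1)) refl t ⟩
  (5 + t) * 2 + (4 + t) * (4 + t + 1)            ≡⟨ cong ((5 + t) * 2 +_) (ramsey₃-bound-triangular t) ⟩
  (5 + t) * 2 + suc (ramsey₃-bound (4 + t)) * 2  ≡⟨ solve 2 (λ t r → (con 5 :+ t) :* con 2 :+ (con 1 :+ r) :* con 2
                                                      := (con 6 :+ t :+ r) :* con 2) refl t (ramsey₃-bound (4 + t)) ⟩
  suc (ramsey₃-bound (5 + t)) * 2                ∎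
  where
  open ≡-Reasoning
  open +-*-Solver

2n≤ramsey₃-bound : ∀ t → 2 * (5 + t) ≤ ramsey₃-bound (5 + t)
2n≤ramsey₃-bound zero    = m≤m+n 10 4
2n≤ramsey₃-bound (suc t) = begin
  2 * (6 + t)                  ≡⟨ solve 1 (λ t → con 2 :* (con 6 :+ t) := con 2 :+ con 2 :* (con 5 :+ t)) refl t ⟩
  2 + 2 * (5 + t)              ≤⟨ +-mono-≤ (m≤m+n 2 (4 + t)) (2n≤ramsey₃-bound t) ⟩
  (6 + t) + ramsey₃-bound (5 + t) ∎
  where
  open ≤-Reasoning
  open +-*-Solver

ramsey₃-bound-large : ∀ {n} → 5 ≤ n → 2 * n ⊔ (ramsey₃-bound n ∸ 1) ≤ (n * (n + 1)) / 2 ∸ 1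
ramsey₃-bound-large {suc (suc (suc (suc (suc t))))} (s≤s (s≤s (s≤s (s≤s (s≤s _))))) = begin
  2 * n ⊔ (ramsey₃-bound n ∸ 1)  ≤⟨ ⊔-lub (2n≤ramsey₃-bound t) (m∸n≤m (ramsey₃-bound n) 1) ⟩
  ramsey₃-bound n                ≡⟨ cong (_∸ 1) (m*n/n≡m (suc (ramsey₃-bound n)) 2) ⟨
  (suc (ramsey₃-bound n) * 2) / 2 ∸ 1  ≡⟨ cong (λ x → x / 2 ∸ 1) (ramsey₃-bound-triangular (suc t)) ⟨
  (n * (n + 1)) / 2 ∸ 1          ∎
  where
  open ≤-Reasoning
  n : ℕ
  n = 5 + t

module ThreeTwoOrthogonal {c ℓ : Level} (F : Field c ℓ) {n : ℕ}
  {B : Vec F n → Vec F n → Field.Carrier F} (isB : IsSymBilinear F B)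
  (D : List (Vec F n)) (o32 : Is32Orthogonal F B D)
  (anisotropic : All (λ x → ¬ Field._≈_ F (B x x) (Field.0# F)) D) where

  open Field F using (_≈_; 0#) renaming (trans to ≈-trans)
  open LinearAlgebra F
  open IsSymBilinear isB using () renaming (sym to B-sym)

  Position : Set
  Position = Fin (length D)

  point : Position → Vec F n
  point = lookup D

  Orthogonal : Position → Position → Set ℓ
  Orthogonal i j = B (point i) (point j) ≈ 0#

  orthogonal-sym : Symmetric Orthogonal
  orthogonal-sym {i} {j} = ≈-trans (B-sym (point j) (point i))

  anisotropic-at : ∀ i → ¬ B (point i) (point i) ≈ 0#
  anisotropic-at i = All.lookup anisotropic (∈-lookup i)

  orthogonal-positions-≤ : ∀ {js} → AllPairs Orthogonal js → length js ≤ n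
  orthogonal-positions-≤ {js} orthogonal =
    independent⇒≤ (point ∘ lookup js)
      (orthogonal⇒independent isB (point ∘ lookup js)
        (λ _ _ → AllPairs-lookup orthogonal-sym orthogonal) (anisotropic-at ∘ lookup js))

  module _ (orthogonal? : ∀ i j → Dec (Orthogonal i j)) where

    orthogonal-n-set⇒≤2n : (g : Fin n → Position) → (∀ i i′ → i ≢ i′ → Orthogonal (g i) (g i′)) →
                           length D ≤ 2 * n
    orthogonal-n-set⇒≤2n g g-orthogonal = begin
      length D                                                              ≡⟨ length-tabulate id ⟨
      length positions                                                      ≡⟨ length-filter-∁ image? positions ⟨
      length (filter image? positions) + length (filter (∁? image?) positions)
        ≤⟨ +-mono-≤ (orthogonal-positions-≤ inside) (orthogonal-positions-≤ outside) ⟩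
      n + n                                                                 ≡⟨ cong (n +_) (+-identityʳ n) ⟨
      2 * n                                                                 ∎
      where
      open ≤-Reasoning
      positions : List Position
      positions = allFin (length D)
      Image : Position → Set
      Image j = ∃ λ i → g i ≡ j
      image? : ∀ j → Dec (Image j)
      image? j = any? (λ i → g i ≟ j)
      orthogonal-outside : ∀ {j j′} → ¬ Image j → ¬ Image j′ → j ≢ j′ → Orthogonal j j′
      orthogonal-outside {j} {j′} j∉g j′∉g j≢j′ with orthogonal? j j′
      ... | yes j⊥j′ = j⊥j′
      ... | no j⊥̸j′  = ⊥-elim (¬¬-orthogonal-of-split isB (point ∘ g) g-orthogonal (anisotropic-at ∘ g)
                                                       (point j) (point j′) split j⊥̸j′)
        where
        split : ∀ i → Orthogonal j (g i) ⊎ Orthogonal j′ (g i)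
        split i with o32 j j′ (g i) j≢j′ (j′∉g ∘ (i ,_) ∘ sym) (j∉g ∘ (i ,_) ∘ sym)
        ... | inj₁ j⊥j′        = contradiction j⊥j′ j⊥̸j′
        ... | inj₂ (inj₁ j′⊥g) = inj₂ j′⊥g
        ... | inj₂ (inj₂ j⊥g)  = inj₁ j⊥g
      inside : AllPairs Orthogonal (filter image? positions)
      inside = Unique⇒AllPairs (λ { (i , refl) (i′ , refl) gi≢gi′ → g-orthogonal i i′ (gi≢gi′ ∘ cong g) })
                               (all-filter image? positions) (Unique.filter⁺ image? (Unique.allFin⁺ _))
      outside : AllPairs Orthogonal (filter (∁? image?) positions)
      outside = Unique⇒AllPairs orthogonal-outside
                                (all-filter (∁? image?) positions) (Unique.filter⁺ (∁? image?) (Unique.allFin⁺ _))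

    non-orthogonal : Position → Position → Bool
    non-orthogonal i j with orthogonal? i j
    ... | yes _ = false
    ... | no _  = true

    non-orthogonal-sym : ∀ i j → non-orthogonal i j ≡ non-orthogonal j i
    non-orthogonal-sym i j with orthogonal? i j | orthogonal? j i
    ... | yes _    | yes _    = refl
    ... | no _     | no _     = refl
    ... | yes i⊥j  | no j⊥̸i   = contradiction (orthogonal-sym i⊥j) j⊥̸i
    ... | no i⊥̸j   | yes j⊥i  = contradiction (orthogonal-sym j⊥i) i⊥̸j

    non-orthogonal-true : ∀ {i j} → non-orthogonal i j ≡ true → ¬ Orthogonal i j
    non-orthogonal-true {i} {j} _ with orthogonal? i j
    ... | no i⊥̸j = i⊥̸j

    non-orthogonal-false : ∀ {i j} → non-orthogonal i j ≡ false → Orthogonal i j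
    non-orthogonal-false {i} {j} _ with orthogonal? i j
    ... | yes i⊥j = i⊥j

    orthogonality-graph : ∀ {m} → m ≤ length D → Graph m
    orthogonality-graph m≤L = record
      { adj     = λ a b → non-orthogonal (inject≤ a m≤L) (inject≤ b m≤L)
      ; adj-sym = λ a b → non-orthogonal-sym (inject≤ a m≤L) (inject≤ b m≤L)
      }

    ramsey⇒≤2n : ∀ {m} → m ≤ length D → RamseyProperty 3 n m → length D ≤ 2 * n
    ramsey⇒≤2n {m} m≤L ramsey = [ ⊥-elim ∘ no-triangle , independent⇒≤2n ] (ramsey (orthogonality-graph m≤L))
      where
      ι : Fin m → Position
      ι a = inject≤ a m≤L
      independent⇒≤2n : HasIndep n (orthogonality-graph m≤L) → length D ≤ 2 * n
      independent⇒≤2n (f , _ , non-adjacent) =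
        orthogonal-n-set⇒≤2n (ι ∘ f) (λ i i′ i≢i′ → non-orthogonal-false (non-adjacent i i′ i≢i′))
      no-triangle : HasClique 3 (orthogonality-graph m≤L) → ⊥
      no-triangle (f , f-injective , adjacent)
        with o32 (ι (f 0F)) (ι (f 1F)) (ι (f 2F)) (distinct λ ()) (distinct λ ()) (distinct λ ())
        where
        distinct : ∀ {i j} → i ≢ j → ι (f i) ≢ ι (f j)
        distinct i≢j = i≢j ∘ f-injective ∘ inject≤-injective m≤L m≤L _ _
      ... | inj₁ o        = non-orthogonal-true (adjacent 0F 1F λ ()) o
      ... | inj₂ (inj₁ o) = non-orthogonal-true (adjacent 1F 2F λ ()) o
      ... | inj₂ (inj₂ o) = non-orthogonal-true (adjacent 0F 2F λ ()) o

    ramsey⇒length-bound : ∀ m → RamseyProperty 3 n m → length D ≤ 2 * n ⊔ (m ∸ 1)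
    ramsey⇒length-bound m ramsey with length D ≤? m ∸ 1
    ... | yes short = m≤n⇒m≤o⊔n (2 * n) short
    ... | no long   = m≤n⇒m≤n⊔o (m ∸ 1) (ramsey⇒≤2n (≤-trans (m≤n+m∸n m 1) (≰⇒> long)) ramsey)

  -- Orthogonality in F is not decidable, but the bound is, so it may be
  -- proved under double negation with orthogonality of positions decided.
  length-bound : ∀ m → RamseyProperty 3 n m → length D ≤ 2 * n ⊔ (m ∸ 1)
  length-bound m ramsey =
    decidable-stable (length D ≤? 2 * n ⊔ (m ∸ 1))
      (¬¬-map (λ orthogonal? → ramsey⇒length-bound orthogonal? m ramsey) (¬¬-∀-Fin λ _ → ¬¬-decide-Fin))

-- Is32Orthogonal speaks about positions in D.
lemma3p10 : ∀ {c ℓ : Level} (F : Field c ℓ) (n : ℕ) → 1 ≤ n →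
    (B : Vec F n → Vec F n → Field.Carrier F) → IsSymBilinear F B →
    (D : List (Vec F n)) → Distinct F D → All (NonZeroVec F) D →
    Is32Orthogonal F B D →
    All (λ x → ¬ (Field._≈_ F (B x x) (Field.0# F))) D →
    (∀ r → IsRamseyNumber 3 n r → length D ≤ (2 * n) ⊔ (r ∸ 1))
      × (n ≤ 4 → length D ≤ 2 * n)
      × (5 ≤ n → length D ≤ ((n * (n + 1)) / 2) ∸ 1)
lemma3p10 F n _ B isB D _ _ o32 anisotropic =
  (λ r (ramsey , _) → length-bound r ramsey) ,
  (λ n≤4 → ≤-trans (length-bound _ (ramsey₃-property n)) (ramsey₃-bound-small n≤4)) ,
  (λ 5≤n → ≤-trans (length-bound _ (ramsey₃-property n)) (ramsey₃-bound-large 5≤n))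
  where open ThreeTwoOrthogonal F isB D o32 anisotropic
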